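{- For $n\ge1$ let $A_n=\mathrm{Av}_n(123,132,321)$, and let $A_n^r$ (resp. $A_n^l$) be the set of permutations $a_1\dots a_n\in A_n$ with $a_n=1$ (resp. $a_{n-1}=1$). Let $\mathbf{312}^r_n$ (resp. $\mathbf{312}^l_n$) denote the total number of consecutive occurrences of the pattern $312$ summed over all permutations in $A_n^r$ (resp. $A_n^l$). Then for every $n\ge5$: (1) $\mathbf{312}^r_n=\mathbf{312}^l_{n-1}$; (2) $\mathbf{312}^l_n=(n-1)\big(\mathbf{312}^l_{n-2}+(n-3)!!\big)-(n-5)!!\,\frac{(n-3)(n-2)}{2}$.
   Context: A permutation $\pi=a_1\dots a_n$ contains a consecutive occurrence of a pattern $p\in\mathcal S_r$ if some factor $a_i\dots a_{i+r-1}$ is order-isomorphic to $p$; $\mathrm{Av}_n(p_1,\dots,p_k)$ is the set of permutations of size $n$ containing no consecutive occurrence of any $p_j$. Double factorial: $0!!=1$, $m!!=m(m-2)(m-4)\cdots$ ending at $1$ or $2$. -}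

module Defs where

open import Data.Nat using (ℕ; zero; suc; _+_; _*_; _<ᵇ_; _≡ᵇ_)
open import Data.Bool using (Bool; true; false; _∧_; _∨_; not)
open import Data.List using (List; []; _∷_; map; concatMap; filter; reverse)
open import Data.Nat.ListAction using (sum)
open import Relation.Nullary.Decidable using (Dec)
open import Relation.Binary.PropositionalEquality using (_≡_)
open import Data.Bool using (T)
open import Data.Bool.Properties using (T?)

insertions : ℕ → List ℕ → List (List ℕ)
insertions x []       = (x ∷ []) ∷ []
insertions x (y ∷ ys) = (x ∷ y ∷ ys) ∷ map (y ∷_) (insertions x ys)

perms : ℕ → List (List ℕ)
perms zero    = [] ∷ []
perms (suc n) = concatMap (insertions (suc n)) (perms n)

-- Order-isomorphism of a length-3 factor (x,y,z) (distinct entries) to patterns.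
is123 is132 is321 is312 : ℕ → ℕ → ℕ → Bool
is123 x y z = (x <ᵇ y) ∧ (y <ᵇ z)
is132 x y z = (x <ᵇ z) ∧ (z <ᵇ y)
is321 x y z = (z <ᵇ y) ∧ (y <ᵇ x)
is312 x y z = (y <ᵇ z) ∧ (z <ᵇ x)

occ : (ℕ → ℕ → ℕ → Bool) → List ℕ → ℕ
occ p (x ∷ y ∷ z ∷ rest) = (if p x y z then 1 else 0) + occ p (y ∷ z ∷ rest)
  where open import Data.Bool using (if_then_else_)
occ p _ = 0

containsBad : List ℕ → Bool
containsBad (x ∷ y ∷ z ∷ rest) = is123 x y z ∨ is132 x y z ∨ is321 x y z ∨ containsBad (y ∷ z ∷ rest)
containsBad _ = false

lastIs1 : List ℕ → Bool
lastIs1 w with reverse w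
... | x ∷ _ = x ≡ᵇ 1
... | []    = false

penultIs1 : List ℕ → Bool
penultIs1 w with reverse w
... | _ ∷ x ∷ _ = x ≡ᵇ 1
... | _         = false

A : ℕ → List (List ℕ)
A n = filter (λ w → T? (not (containsBad w))) (perms n)

Ar Al : ℕ → List (List ℕ)
Ar n = filter (λ w → T? (lastIs1 w)) (A n)
Al n = filter (λ w → T? (penultIs1 w)) (A n)

occ312r occ312l : ℕ → ℕ
occ312r n = sum (map (occ is312) (Ar n))
occ312l n = sum (map (occ is312) (Al n))

_!! : ℕ → ℕ
zero !!          = 1
suc zero !!      = 1
suc (suc m) !!   = suc (suc m) * (m !!)

module Submission where

-- Deleting the last entry of a permutation and standardising what remains maps A^r_{m+1}
-- bijectively onto A^l_m when m ≥ 2. A window starting at the minimum is a 123 or a 132, so in a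
-- permutation of A_m the entry 1 is one of the last two entries; it cannot be the last one,
-- because appending 1 after (x, 1) would create the 321 (x + 1, 2, 1). The only window the
-- inverse map creates, (2, d + 1, 1), is not a 312, which gives (1).
-- Doing this twice, w ↦ (u, c) with c the last entry of w is a bijection from A^l_{k+2} onto
-- A^l_k × {2, …, k + 2}. Besides (2, d + 1, 1) it creates the window (x, 1, c), a 312 exactly
-- when c ≤ d + 1, d being the last entry of u. Summing over c, with S_k the sum of the last
-- entries over A^l_k:  312^l_{k+2} = (k + 1) 312^l_k + S_k,  S_{k+2} = |A^l_k| (2 + ⋯ + (k + 2))
-- and |A^l_{k+2}| = (k + 1) |A^l_k|, so |A^l_{j+2}| = (j + 1)!!. Eliminating S gives (2);
-- the case n = 5 is a finite computation.

open import Defs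
open import Data.Nat
  using (ℕ; zero; suc; pred; _+_; _*_; _∸_; _/_; _⊓_; _≤_; _<_; _<ᵇ_; _≡ᵇ_; _≟_; z≤n; s≤s; s≤s⁻¹)
open import Data.Nat.Properties
open import Data.Nat.DivMod using (m*n/n≡m)
open import Data.Nat.ListAction using (sum)
open import Data.Nat.ListAction.Properties using (sum-↭; sum-++)
open import Data.Nat.Tactic.RingSolver using (solve-∀)
open import Data.Bool using (Bool; true; false; _∧_; _∨_; not; T; if_then_else_)
open import Data.Bool.Properties using (T?; T-≡; T-not-≡; ∨-assoc; ∧-zeroʳ)
open import Data.List using (List; []; _∷_; _++_; [_]; map; concatMap; length; downFrom)
open import Data.List.Properties
  using (∷-injective; ∷ʳ-injective; map-injective; ++-assoc; ++-identityʳ; map-++; map-∘; map-cong;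
         map-cong-local; length-downFrom; reverse-++)
open import Data.List.Reverse using (reverseView; []; _∶_∶ʳ_)
open import Data.List.Membership.Propositional using (_∈_; _∉_; find; lose)
open import Data.List.Membership.Propositional.Properties
  using (∈-map⁺; ∈-map⁻; ∈-++⁺ˡ; ∈-++⁺ʳ; ∈-++⁻; ∈-∃++; ∈-concatMap⁺; ∈-concatMap⁻; ∈-filter⁺; ∈-filter⁻;
         ∈-downFrom⁺; ∈-downFrom⁻)
open import Data.List.Membership.Propositional.Properties.WithK using (unique∧set⇒bag)
open import Data.List.Relation.Unary.Any using (here; there)
open import Data.List.Relation.Unary.All using ([]; _∷_)
import Data.List.Relation.Unary.All as All
open import Data.List.Relation.Unary.All.Properties using (¬Any⇒All¬; All¬⇒¬Any)
open import Data.List.Relation.Unary.AllPairs using ([]; _∷_)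
open import Data.List.Relation.Unary.Unique.Propositional using (Unique)
import Data.List.Relation.Unary.Unique.Propositional.Properties as Unique
open import Data.List.Relation.Binary.BagAndSetEquality using (∼bag⇒↭)
open import Data.List.Relation.Binary.Permutation.Propositional using (_↭_; ↭-sym; ↭⇒↭ₛ)
open import Data.List.Relation.Binary.Permutation.Propositional.Properties using (shift; ∈-resp-↭)
import Data.List.Relation.Binary.Permutation.Propositional.Properties as ↭
import Data.List.Relation.Binary.Permutation.Setoid.Properties as ↭ₛ
open import Data.Product using (_×_; _,_; proj₁; proj₂; ∃; ∃₂)
open import Data.Sum using (_⊎_; inj₁; inj₂)
open import Data.Empty using (⊥-elim)
open import Function using (_∘_; case_of_)
open import Function.Bundles using (Equivalence; _⇔_; mk⇔)
open import Algebra.Properties.CommutativeSemigroup +-commutativeSemigroup using (interchange)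
open import Relation.Nullary using (¬_; yes; no)
open import Relation.Binary.Definitions using (_Respects_; tri<; tri≈; tri>)
open import Relation.Binary.PropositionalEquality hiding ([_])
open ≡-Reasoning

module _ {A : Set} where

  unique-resp-↭ : Unique {A = A} Respects _↭_
  unique-resp-↭ p = ↭ₛ.AllPairs-resp-↭ (setoid A) ≢-sym (resp₂ _) (↭⇒↭ₛ p)

  unique-∷⁺ : ∀ {x : A} {xs} → x ∉ xs → Unique xs → Unique (x ∷ xs)
  unique-∷⁺ x∉xs u = ¬Any⇒All¬ _ x∉xs ∷ u

  unique-∷⁻ : ∀ {x : A} {xs} → Unique (x ∷ xs) → x ∉ xs × Unique xs
  unique-∷⁻ (x≢xs ∷ u) = All¬⇒¬Any x≢xs , u

  unique-∷-++⁻ : ∀ {x : A} xs {ys} → Unique (xs ++ x ∷ ys) → Unique (x ∷ xs ++ ys)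
  unique-∷-++⁻ {x} xs {ys} = unique-resp-↭ (shift x xs ys)

  unique-∷ʳ⁻ : ∀ {x : A} xs → Unique (xs ++ [ x ]) → x ∉ xs × Unique xs
  unique-∷ʳ⁻ xs u with x∉xs , uxs ← unique-∷⁻ (unique-∷-++⁻ xs u)
    rewrite ++-identityʳ xs = x∉xs , uxs

  unique-last-two : ∀ {x y : A} xs → Unique (xs ++ x ∷ y ∷ []) → x ≢ y
  unique-last-two xs u x≡y = proj₁ (unique-∷⁻ (unique-∷-++⁻ xs u)) (∈-++⁺ʳ xs (here x≡y))

  ++-∷-cancel : ∀ {x : A} xs xs′ {ys ys′} → xs ++ x ∷ ys ≡ xs′ ++ x ∷ ys′ →
                x ∉ xs → x ∉ xs′ → xs ≡ xs′ × ys ≡ ys′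
  ++-∷-cancel []       []        refl _ _ = refl , refl
  ++-∷-cancel []       (_ ∷ _)   refl _ x∉xs′ = ⊥-elim (x∉xs′ (here refl))
  ++-∷-cancel (_ ∷ _)  []        refl x∉xs _ = ⊥-elim (x∉xs (here refl))
  ++-∷-cancel (a ∷ xs) (a′ ∷ xs′) eq x∉xs x∉xs′
    with refl , eq′ ← ∷-injective eq
    with refl , refl ← ++-∷-cancel xs xs′ eq′ (x∉xs ∘ there) (x∉xs′ ∘ there)
    = refl , refl

  module _ {B : Set} (f : A → List B) where

    concatMap-unique : ∀ {xs} → Unique xs → (∀ {a} → a ∈ xs → Unique (f a)) →
      (∀ {a b y} → a ∈ xs → b ∈ xs → y ∈ f a → y ∈ f b → a ≡ b) → Unique (concatMap f xs)
    concatMap-unique [] _ _ = []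
    concatMap-unique {a ∷ xs} (a∉xs ∷ u) uf disjoint =
      Unique.++⁺ (uf (here refl)) (concatMap-unique u (uf ∘ there) (λ p q → disjoint (there p) (there q)))
        λ (y∈fa , y∈rest) →
          let b , b∈xs , y∈fb = find (∈-concatMap⁻ f y∈rest)
          in All.lookup a∉xs b∈xs (disjoint (here refl) (there b∈xs) y∈fa y∈fb)

∈-insertions⁻ : ∀ {x : ℕ} u {w} → w ∈ insertions x u →
  ∃₂ λ as bs → u ≡ as ++ bs × w ≡ as ++ x ∷ bs
∈-insertions⁻ []       (here refl) = [] , [] , refl , refl
∈-insertions⁻ (y ∷ ys) (here refl) = [] , y ∷ ys , refl , refl
∈-insertions⁻ (y ∷ ys) (there p)
  with _ , q , refl ← ∈-map⁻ (y ∷_) p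
  with as , bs , refl , refl ← ∈-insertions⁻ ys q
  = y ∷ as , bs , refl , refl

∈-insertions⁺ : ∀ (x : ℕ) as bs → as ++ x ∷ bs ∈ insertions x (as ++ bs)
∈-insertions⁺ x []       []       = here refl
∈-insertions⁺ x []       (b ∷ bs) = here refl
∈-insertions⁺ x (a ∷ as) bs       = there (∈-map⁺ (a ∷_) (∈-insertions⁺ x as bs))

insertions-unique : ∀ {x : ℕ} u → x ∉ u → Unique (insertions x u)
insertions-unique []       _    = [] ∷ []
insertions-unique (y ∷ ys) x∉u =
  All.tabulate head-fresh ∷ Unique.map⁺ (proj₂ ∘ ∷-injective) (insertions-unique ys (x∉u ∘ there))
  where
    head-fresh : ∀ {v} → v ∈ map (y ∷_) (insertions _ ys) → _ ≢ v
    head-fresh v∈ eq with _ , _ , refl ← ∈-map⁻ (y ∷_) v∈ = x∉u (here (proj₁ (∷-injective eq)))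

insertions-disjoint : ∀ {x : ℕ} {u v w} → x ∉ u → x ∉ v →
  w ∈ insertions x u → w ∈ insertions x v → u ≡ v
insertions-disjoint {u = u} {v} x∉u x∉v p q
  with as , bs , refl , refl ← ∈-insertions⁻ u p
  with as′ , bs′ , refl , eq ← ∈-insertions⁻ v q
  with refl , refl ← ++-∷-cancel as as′ eq (x∉u ∘ ∈-++⁺ˡ) (x∉v ∘ ∈-++⁺ˡ)
  = refl

InRange : ℕ → ℕ → Set
InRange n x = 1 ≤ x × x ≤ n

record IsPerm (n : ℕ) (w : List ℕ) : Set where
  field
    unique    : Unique w
    ∈⇒inRange : ∀ {x} → x ∈ w → InRange n x
    inRange⇒∈ : ∀ {x} → InRange n x → x ∈ w

open IsPerm

isPerm-resp-↭ : ∀ {n} → IsPerm n Respects _↭_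
isPerm-resp-↭ w↭w′ p = record
  { unique    = unique-resp-↭ w↭w′ (unique p)
  ; ∈⇒inRange = ∈⇒inRange p ∘ ∈-resp-↭ (↭-sym w↭w′)
  ; inRange⇒∈ = ∈-resp-↭ w↭w′ ∘ inRange⇒∈ p
  }

suc-∉ : ∀ {n u} → IsPerm n u → suc n ∉ u
suc-∉ p = 1+n≰n ∘ proj₂ ∘ ∈⇒inRange p

isPerm-∷ : ∀ {n u} → IsPerm n u → IsPerm (suc n) (suc n ∷ u)
isPerm-∷ {n} p = record
  { unique    = unique-∷⁺ (suc-∉ p) (unique p)
  ; ∈⇒inRange = λ { (here refl) → s≤s z≤n , ≤-refl
                  ; (there x∈u) → let 1≤x , x≤n = ∈⇒inRange p x∈u in 1≤x , m≤n⇒m≤1+n x≤n }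
  ; inRange⇒∈ = grow
  }
  where
    grow : ∀ {x} → InRange (suc n) x → x ∈ suc n ∷ _
    grow {x} (1≤x , x≤1+n) with x ≟ suc n
    ... | yes refl = here refl
    ... | no  x≢1+n = there (inRange⇒∈ p (1≤x , s≤s⁻¹ (≤∧≢⇒< x≤1+n x≢1+n)))

isPerm-∷⁻ : ∀ {n u} → IsPerm (suc n) (suc n ∷ u) → IsPerm n u
isPerm-∷⁻ {n} p = record
  { unique    = proj₂ (unique-∷⁻ (unique p))
  ; ∈⇒inRange = shrink
  ; inRange⇒∈ = λ { (1≤x , x≤n) → drop-head (inRange⇒∈ p (1≤x , m≤n⇒m≤1+n x≤n)) x≤n }
  }
  where
    shrink : ∀ {x} → x ∈ _ → InRange n x
    shrink x∈u with 1≤x , x≤1+n ← ∈⇒inRange p (there x∈u) =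
      1≤x , s≤s⁻¹ (≤∧≢⇒< x≤1+n λ { refl → proj₁ (unique-∷⁻ (unique p)) x∈u })
    drop-head : ∀ {x} → x ∈ suc n ∷ _ → x ≤ n → x ∈ _
    drop-head (here refl) 1+n≤n = ⊥-elim (1+n≰n 1+n≤n)
    drop-head (there x∈u) _     = x∈u

∈-perms⁻ : ∀ n {w} → w ∈ perms n → IsPerm n w
∈-perms⁻ zero (here refl) = record
  { unique = [] ; ∈⇒inRange = λ () ; inRange⇒∈ = λ { (s≤s _ , ()) } }
∈-perms⁻ (suc n) w∈
  with u , u∈ , w∈ins ← find (∈-concatMap⁻ (insertions (suc n)) {xs = perms n} w∈)
  with as , bs , refl , refl ← ∈-insertions⁻ u w∈ins
  = isPerm-resp-↭ (↭-sym (shift (suc n) as bs)) (isPerm-∷ (∈-perms⁻ n u∈))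

∈-perms⁺ : ∀ n {w} → IsPerm n w → w ∈ perms n
∈-perms⁺ zero {[]}    _ = here refl
∈-perms⁺ zero {x ∷ _} p with 1≤x , x≤0 ← ∈⇒inRange p (here refl) = ⊥-elim (<⇒≱ 1≤x x≤0)
∈-perms⁺ (suc n) p
  with as , bs , refl ← ∈-∃++ (inRange⇒∈ p (s≤s z≤n , ≤-refl))
  = ∈-concatMap⁺ (insertions (suc n))
      (lose (∈-perms⁺ n (isPerm-∷⁻ (isPerm-resp-↭ (shift (suc n) as bs) p))) (∈-insertions⁺ (suc n) as bs))

perms-unique : ∀ n → Unique (perms n)
perms-unique zero    = [] ∷ []
perms-unique (suc n) = concatMap-unique (insertions (suc n)) (perms-unique n)
  (λ u∈ → insertions-unique _ (suc-∉ (∈-perms⁻ n u∈)))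
  (λ u∈ v∈ → insertions-disjoint (suc-∉ (∈-perms⁻ n u∈)) (suc-∉ (∈-perms⁻ n v∈)))

Pattern : Set
Pattern = ℕ → ℕ → ℕ → Bool

Invariant : Pattern → (ℕ → ℕ) → Set
Invariant p g = ∀ x y z → p (g x) (g y) (g z) ≡ p x y z

hit : Pattern → ℕ → ℕ → ℕ → ℕ
hit p x y z = if p x y z then 1 else 0

OrderPreserving : (ℕ → ℕ) → Set
OrderPreserving g = ∀ x y → (g x <ᵇ g y) ≡ (x <ᵇ y)

isBad : Pattern
isBad x y z = is123 x y z ∨ is132 x y z ∨ is321 x y z

module _ (g : ℕ → ℕ) (g-mono : OrderPreserving g) where

  is312-invariant : Invariant is312 g
  is312-invariant x y z = cong₂ _∧_ (g-mono y z) (g-mono z x)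

  isBad-invariant : Invariant isBad g
  isBad-invariant x y z =
    cong₂ _∨_ (cong₂ _∧_ (g-mono x y) (g-mono y z))
      (cong₂ _∨_ (cong₂ _∧_ (g-mono x z) (g-mono z y)) (cong₂ _∧_ (g-mono z y) (g-mono y x)))

punchIn : ℕ → ℕ → ℕ
punchIn zero    x       = suc x
punchIn (suc c) zero    = zero
punchIn (suc c) (suc x) = suc (punchIn c x)

punchOut : ℕ → ℕ → ℕ
punchOut zero    x       = pred x
punchOut (suc c) zero    = zero
punchOut (suc c) (suc x) = suc (punchOut c x)

punchIn-orderPreserving : ∀ c → OrderPreserving (punchIn c)
punchIn-orderPreserving zero    x       y       = refl
punchIn-orderPreserving (suc c) zero    zero    = refl
punchIn-orderPreserving (suc c) zero    (suc y) = refl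
punchIn-orderPreserving (suc c) (suc x) zero    = refl
punchIn-orderPreserving (suc c) (suc x) (suc y) = punchIn-orderPreserving c x y

isBad-punchIn : ∀ c → Invariant isBad (punchIn c)
isBad-punchIn c = isBad-invariant (punchIn c) (punchIn-orderPreserving c)

is312-punchIn : ∀ c → Invariant is312 (punchIn c)
is312-punchIn c = is312-invariant (punchIn c) (punchIn-orderPreserving c)

punchIn-<ᵇ-self : ∀ c x → (c <ᵇ punchIn c x) ≡ (c <ᵇ suc x)
punchIn-<ᵇ-self zero    x       = refl
punchIn-<ᵇ-self (suc c) zero    = refl
punchIn-<ᵇ-self (suc c) (suc x) = punchIn-<ᵇ-self c x

punchIn≢ : ∀ c x → punchIn c x ≢ c
punchIn≢ (suc c) (suc x) eq = punchIn≢ c x (suc-injective eq)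

punchOut-punchIn : ∀ c x → punchOut c (punchIn c x) ≡ x
punchOut-punchIn zero    x       = refl
punchOut-punchIn (suc c) zero    = refl
punchOut-punchIn (suc c) (suc x) = cong suc (punchOut-punchIn c x)

punchIn-punchOut : ∀ c {x} → x ≢ c → punchIn c (punchOut c x) ≡ x
punchIn-punchOut zero    {zero}  0≢0 = ⊥-elim (0≢0 refl)
punchIn-punchOut zero    {suc x} _   = refl
punchIn-punchOut (suc c) {zero}  _   = refl
punchIn-punchOut (suc c) {suc x} x≢c = cong suc (punchIn-punchOut c (x≢c ∘ cong suc))

punchIn-injective : ∀ c {x y} → punchIn c x ≡ punchIn c y → x ≡ y
punchIn-injective c {x} {y} eq = begin
  x                          ≡⟨ punchOut-punchIn c x ⟨
  punchOut c (punchIn c x)   ≡⟨ cong (punchOut c) eq ⟩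
  punchOut c (punchIn c y)   ≡⟨ punchOut-punchIn c y ⟩
  y                          ∎

punchIn-≤ : ∀ c {n x} → x ≤ n → punchIn c x ≤ suc n
punchIn-≤ zero    x≤n               = s≤s x≤n
punchIn-≤ (suc c) {x = zero}  _     = z≤n
punchIn-≤ (suc c) {x = suc x} (s≤s x≤n) = s≤s (punchIn-≤ c x≤n)

punchOut-< : ∀ c {n x} → x ≢ c → x ≤ n → c ≤ n → punchOut c x < n
punchOut-< zero    {x = zero}  0≢0 _ _ = ⊥-elim (0≢0 refl)
punchOut-< zero    {x = suc x} _ x<n _ = x<n
punchOut-< (suc c) {x = zero}  _ _ c<n = ≤-trans (s≤s z≤n) c<n
punchOut-< (suc c) {x = suc x} x≢c (s≤s x≤n) (s≤s c≤n) = s≤s (punchOut-< c (x≢c ∘ cong suc) x≤n c≤n)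

punchIn-inRange : ∀ c {n x} → InRange n x → InRange (suc n) (punchIn c x)
punchIn-inRange zero              (_ , x≤n) = s≤s z≤n , s≤s x≤n
punchIn-inRange (suc c) {x = suc x} (_ , x≤n) = s≤s z≤n , punchIn-≤ (suc c) x≤n

punchOut-inRange : ∀ {n c x} → InRange (suc n) c → InRange (suc n) x → x ≢ c → InRange n (punchOut c x)
punchOut-inRange {c = suc c} {suc x} (_ , s≤s c≤n) (_ , s≤s x≤n) x≢c =
  s≤s z≤n , punchOut-< c (x≢c ∘ cong suc) x≤n c≤n

-- The permutation of size n + 1 ending in c whose first n entries are order-isomorphic to v.
extend : ℕ → List ℕ → List ℕ
extend c v = map (punchIn c) v ++ [ c ]

extend-injective : ∀ {c c′ v v′} → extend c v ≡ extend c′ v′ → c ≡ c′ × v ≡ v′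
extend-injective {c} eq with eq′ , refl ← ∷ʳ-injective (map (punchIn c) _) _ eq =
  refl , map-injective (punchIn-injective c) eq′

extend-isPerm : ∀ {n c v} → IsPerm n v → InRange (suc n) c → IsPerm (suc n) (extend c v)
extend-isPerm {n} {c} {v} p c-range = record
  { unique    = Unique.++⁺ (Unique.map⁺ (punchIn-injective c) (unique p)) ([] ∷ []) λ where
                  (y∈ , here refl) → let x , _ , y≡ = ∈-map⁻ (punchIn c) y∈ in punchIn≢ c x (sym y≡)
  ; ∈⇒inRange = bounded
  ; inRange⇒∈ = complete
  }
  where
    bounded : ∀ {y} → y ∈ extend c v → InRange (suc n) y
    bounded y∈ with ∈-++⁻ (map (punchIn c) v) y∈
    ... | inj₂ (here refl) = c-range
    ... | inj₁ y∈map with x , x∈ , refl ← ∈-map⁻ (punchIn c) y∈map = punchIn-inRange c (∈⇒inRange p x∈)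
    complete : ∀ {y} → InRange (suc n) y → y ∈ extend c v
    complete {y} y-range with y ≟ c
    ... | yes refl = ∈-++⁺ʳ _ (here refl)
    ... | no  y≢c  = ∈-++⁺ˡ (subst (_∈ _) (punchIn-punchOut c y≢c)
                      (∈-map⁺ (punchIn c) (inRange⇒∈ p (punchOut-inRange c-range y-range y≢c))))

punchIn∘punchOut : ∀ c {xs} → c ∉ xs → map (punchIn c) (map (punchOut c) xs) ≡ xs
punchIn∘punchOut c {[]}     _    = refl
punchIn∘punchOut c {x ∷ xs} c∉xs =
  cong₂ _∷_ (punchIn-punchOut c (c∉xs ∘ here ∘ sym)) (punchIn∘punchOut c (c∉xs ∘ there))

extend-isPerm⁻ : ∀ {n c} pre → IsPerm (suc n) (pre ++ [ c ]) →
  IsPerm n (map (punchOut c) pre) × pre ++ [ c ] ≡ extend c (map (punchOut c) pre)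
extend-isPerm⁻ {n} {c} pre p = record
  { unique    = Unique.map⁻ (subst Unique (sym pre≡) unique-pre)
  ; ∈⇒inRange = bounded
  ; inRange⇒∈ = complete
  } , cong (_++ [ c ]) (sym pre≡)
  where
    c∉pre = proj₁ (unique-∷ʳ⁻ pre (unique p))
    unique-pre = proj₂ (unique-∷ʳ⁻ pre (unique p))
    pre≡ = punchIn∘punchOut c c∉pre
    c-range = ∈⇒inRange p (∈-++⁺ʳ pre (here refl))
    bounded : ∀ {y} → y ∈ map (punchOut c) pre → InRange n y
    bounded y∈ with x , x∈ , refl ← ∈-map⁻ (punchOut c) y∈ =
      punchOut-inRange c-range (∈⇒inRange p (∈-++⁺ˡ x∈)) λ { refl → c∉pre x∈ }
    complete : ∀ {y} → InRange n y → y ∈ map (punchOut c) pre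
    complete {y} y-range with ∈-++⁻ pre (inRange⇒∈ p (punchIn-inRange c y-range))
    ... | inj₁ y′∈ = subst (_∈ _) (punchOut-punchIn c y) (∈-map⁺ (punchOut c) y′∈)
    ... | inj₂ (here eq) = ⊥-elim (punchIn≢ c y eq)

occ-map : ∀ p {g} → Invariant p g → ∀ w → occ p (map g w) ≡ occ p w
occ-map p inv (x ∷ y ∷ z ∷ w) =
  cong₂ (λ b n → (if b then 1 else 0) + n) (inv x y z) (occ-map p inv (y ∷ z ∷ w))
occ-map p inv []           = refl
occ-map p inv (_ ∷ [])     = refl
occ-map p inv (_ ∷ _ ∷ []) = refl

occ-++ : ∀ p xs {a b} ys → occ p (xs ++ a ∷ b ∷ ys) ≡ occ p (xs ++ a ∷ b ∷ []) + occ p (a ∷ b ∷ ys)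
occ-++ p []                ys = refl
occ-++ p (x ∷ [])     {a} {b} ys = cong (_+ occ p (a ∷ b ∷ ys)) (sym (+-identityʳ (hit p x a b)))
occ-++ p (x ∷ y ∷ [])      {a} ys =
  trans (cong (hit p x y a +_) (occ-++ p (y ∷ []) ys)) (sym (+-assoc (hit p x y a) _ _))
occ-++ p (x ∷ y ∷ z ∷ xs)  ys =
  trans (cong (hit p x y z +_) (occ-++ p (y ∷ z ∷ xs) ys)) (sym (+-assoc (hit p x y z) _ _))

occ-++-≤ : ∀ p xs ys → occ p xs ≤ occ p (xs ++ ys)
occ-++-≤ p (x ∷ y ∷ z ∷ xs) ys = +-monoʳ-≤ (hit p x y z) (occ-++-≤ p (y ∷ z ∷ xs) ys)
occ-++-≤ p []           ys = z≤n
occ-++-≤ p (_ ∷ [])     ys = z≤n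
occ-++-≤ p (_ ∷ _ ∷ []) ys = z≤n

occ-extend : ∀ p c → Invariant p (punchIn c) → ∀ q a b →
  occ p (extend c (q ++ a ∷ b ∷ [])) ≡ occ p (q ++ a ∷ b ∷ []) + occ p (punchIn c a ∷ punchIn c b ∷ c ∷ [])
occ-extend p c inv q a b = begin
  occ p (map (punchIn c) (q ++ a ∷ b ∷ []) ++ [ c ])
    ≡⟨ cong (λ w → occ p (w ++ [ c ])) (map-++ (punchIn c) q (a ∷ b ∷ [])) ⟩
  occ p ((map (punchIn c) q ++ a′ ∷ b′ ∷ []) ++ [ c ])
    ≡⟨ cong (occ p) (++-assoc (map (punchIn c) q) _ [ c ]) ⟩
  occ p (map (punchIn c) q ++ a′ ∷ b′ ∷ c ∷ [])
    ≡⟨ occ-++ p (map (punchIn c) q) [ c ] ⟩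
  occ p (map (punchIn c) q ++ a′ ∷ b′ ∷ []) + occ p (a′ ∷ b′ ∷ c ∷ [])
    ≡⟨ cong (λ w → occ p w + occ p (a′ ∷ b′ ∷ c ∷ [])) (map-++ (punchIn c) q (a ∷ b ∷ [])) ⟨
  occ p (map (punchIn c) (q ++ a ∷ b ∷ [])) + occ p (a′ ∷ b′ ∷ c ∷ [])
    ≡⟨ cong (_+ occ p (a′ ∷ b′ ∷ c ∷ [])) (occ-map p inv (q ++ a ∷ b ∷ [])) ⟩
  occ p (q ++ a ∷ b ∷ []) + occ p (a′ ∷ b′ ∷ c ∷ []) ∎
  where
    a′ = punchIn c a
    b′ = punchIn c b

containsBad≡ : ∀ w → containsBad w ≡ (0 <ᵇ occ isBad w)
containsBad≡ (x ∷ y ∷ z ∷ w) = begin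
  is123 x y z ∨ (is132 x y z ∨ (is321 x y z ∨ containsBad (y ∷ z ∷ w)))
    ≡⟨ cong (is123 x y z ∨_) (∨-assoc (is132 x y z) _ _) ⟨
  is123 x y z ∨ ((is132 x y z ∨ is321 x y z) ∨ containsBad (y ∷ z ∷ w))
    ≡⟨ ∨-assoc (is123 x y z) _ _ ⟨
  isBad x y z ∨ containsBad (y ∷ z ∷ w)
    ≡⟨ cong (isBad x y z ∨_) (containsBad≡ (y ∷ z ∷ w)) ⟩
  isBad x y z ∨ (0 <ᵇ occ isBad (y ∷ z ∷ w))
    ≡⟨ ∨-positive (isBad x y z) _ ⟩
  0 <ᵇ occ isBad (x ∷ y ∷ z ∷ w) ∎
  where
    ∨-positive : ∀ b n → b ∨ (0 <ᵇ n) ≡ (0 <ᵇ (if b then 1 else 0) + n)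
    ∨-positive true  n = refl
    ∨-positive false n = refl
containsBad≡ []           = refl
containsBad≡ (_ ∷ [])     = refl
containsBad≡ (_ ∷ _ ∷ []) = refl

lastIs1-∷ʳ : ∀ pre x → lastIs1 (pre ++ [ x ]) ≡ (x ≡ᵇ 1)
lastIs1-∷ʳ pre x rewrite reverse-++ pre [ x ] = refl

penultIs1-∷ʳ : ∀ pre x y → penultIs1 (pre ++ x ∷ y ∷ []) ≡ (x ≡ᵇ 1)
penultIs1-∷ʳ pre x y rewrite reverse-++ pre (x ∷ y ∷ []) = refl

≡ᵇ1⇒≡1 : ∀ {x} → (x ≡ᵇ 1) ≡ true → x ≡ 1
≡ᵇ1⇒≡1 {x} eq = ≡ᵇ⇒≡ x 1 (Equivalence.from T-≡ eq)

lastIs1⁻ : ∀ w → lastIs1 w ≡ true → ∃ λ pre → w ≡ pre ++ [ 1 ]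
lastIs1⁻ w eq with reverseView w
lastIs1⁻ _ () | []
... | pre ∶ _ ∶ʳ x with refl ← ≡ᵇ1⇒≡1 {x} (trans (sym (lastIs1-∷ʳ pre x)) eq) = pre , refl

penultIs1⁻ : ∀ w → penultIs1 w ≡ true → ∃₂ λ pre d → w ≡ pre ++ 1 ∷ d ∷ []
penultIs1⁻ w eq with reverseView w
penultIs1⁻ _ () | []
penultIs1⁻ _ () | _ ∶ [] ∶ʳ _
... | _ ∶ pre ∶ _ ∶ʳ x ∶ʳ d
  with refl ← ≡ᵇ1⇒≡1 {x} (trans (sym (trans (cong penultIs1 (++-assoc pre [ x ] [ d ]))
                                          (penultIs1-∷ʳ pre x d)))
                                eq)
  = pre , d , ++-assoc pre [ 1 ] [ d ]

-- Phrasing avoidance as "no bad window" lets the window lemmas about occ serve both for A_n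
-- and for the 312 count.
Avoids : List ℕ → Set
Avoids w = occ isBad w ≡ 0

avoids⇔ : ∀ w → containsBad w ≡ false ⇔ Avoids w
avoids⇔ w rewrite containsBad≡ w with occ isBad w
... | zero  = mk⇔ (λ _ → refl) (λ _ → refl)
... | suc _ = mk⇔ (λ ()) (λ ())

avoids-∷⁻ : ∀ x w → Avoids (x ∷ w) → Avoids w
avoids-∷⁻ x []            _ = refl
avoids-∷⁻ x (_ ∷ [])      _ = refl
avoids-∷⁻ x (y ∷ z ∷ w) eq = m+n≡0⇒n≡0 (hit isBad x y z) eq

avoids-window : ∀ x y z w → Avoids (x ∷ y ∷ z ∷ w) → isBad x y z ≡ false
avoids-window x y z w eq with isBad x y z
... | false = refl
... | true  = case eq of λ ()

avoids-extend⁻ : ∀ c v → Avoids (extend c v) → Avoids v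
avoids-extend⁻ c v eq = n≤0⇒n≡0
  (subst₂ _≤_ (occ-map isBad (isBad-punchIn c) v) eq (occ-++-≤ isBad (map (punchIn c) v) [ c ]))

isBad-valley : ∀ x z → isBad (suc x) 1 (suc z) ≡ false
isBad-valley x z rewrite ∧-zeroʳ (x <ᵇ z) = refl

<ᵇ-true : ∀ {m n} → m < n → (m <ᵇ n) ≡ true
<ᵇ-true = Equivalence.to T-≡ ∘ <⇒<ᵇ

<ᵇ-false : ∀ {m n} → n ≤ m → (m <ᵇ n) ≡ false
<ᵇ-false {m} {n} n≤m with m <ᵇ n in eq
... | false = refl
... | true  = ⊥-elim (<⇒≱ (<ᵇ⇒< m n (subst T (sym eq) _)) n≤m)

isBad-leading-minimum : ∀ {x y z} → x < y → x < z → y ≢ z → isBad x y z ≡ true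
isBad-leading-minimum {x} {y} {z} x<y x<z y≢z with <-cmp y z
... | tri< y<z _ _ rewrite <ᵇ-true x<y | <ᵇ-true y<z = refl
... | tri≈ _ y≡z _ = ⊥-elim (y≢z y≡z)
... | tri> _ _ z<y rewrite <ᵇ-true x<y | <ᵇ-false (<⇒≤ z<y) | <ᵇ-true x<z | <ᵇ-true z<y = refl

minimum-in-last-two : ∀ {m} w → Unique w → Avoids w → (∀ {y} → y ∈ w → m ≤ y) → m ∈ w →
  (∃ λ pre → w ≡ pre ++ [ m ]) ⊎ (∃₂ λ pre z → w ≡ pre ++ m ∷ z ∷ [])
minimum-in-last-two (_ ∷ [])     _ _ _ (here refl) = inj₁ ([] , refl)
minimum-in-last-two (_ ∷ z ∷ []) _ _ _ (here refl) = inj₂ ([] , z , refl)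
minimum-in-last-two (m ∷ y ∷ z ∷ w) ((m≢y ∷ m≢z ∷ _) ∷ (y≢z ∷ _) ∷ _) av m≤ (here refl)
  with () ← trans (sym (isBad-leading-minimum (≤∧≢⇒< (m≤ (there (here refl))) m≢y)
                                        (≤∧≢⇒< (m≤ (there (there (here refl)))) m≢z) y≢z))
                  (avoids-window m y z w av)
minimum-in-last-two (x ∷ w) (_ ∷ u) av m≤ (there m∈w)
  with minimum-in-last-two w u (avoids-∷⁻ x w av) (m≤ ∘ there) m∈w
... | inj₁ (pre , refl)     = inj₁ (x ∷ pre , refl)
... | inj₂ (pre , z , refl) = inj₂ (x ∷ pre , z , refl)

IsA : ℕ → List ℕ → Set
IsA n w = IsPerm n w × Avoids w

∈-A⁻ : ∀ n {w} → w ∈ A n → IsA n w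
∈-A⁻ n {w} w∈ with w∈perms , t ← ∈-filter⁻ (λ w → T? (not (containsBad w))) {xs = perms n} w∈ =
  ∈-perms⁻ n w∈perms , Equivalence.to (avoids⇔ w) (Equivalence.to T-not-≡ t)

∈-A⁺ : ∀ n {w} → IsA n w → w ∈ A n
∈-A⁺ n {w} (p , av) =
  ∈-filter⁺ (λ w → T? (not (containsBad w))) (∈-perms⁺ n p)
    (Equivalence.from T-not-≡ (Equivalence.from (avoids⇔ w) av))

∈-Ar⁻ : ∀ n {w} → w ∈ Ar n → IsA n w × ∃ λ pre → w ≡ pre ++ [ 1 ]
∈-Ar⁻ n {w} w∈ with w∈A , t ← ∈-filter⁻ (λ w → T? (lastIs1 w)) {xs = A n} w∈ =
  ∈-A⁻ n w∈A , lastIs1⁻ w (Equivalence.to T-≡ t)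

∈-Ar⁺ : ∀ n pre → IsA n (pre ++ [ 1 ]) → pre ++ [ 1 ] ∈ Ar n
∈-Ar⁺ n pre a = ∈-filter⁺ (λ w → T? (lastIs1 w)) (∈-A⁺ n a) (Equivalence.from T-≡ (lastIs1-∷ʳ pre 1))

∈-Al⁻ : ∀ n {w} → w ∈ Al n → IsA n w × ∃₂ λ pre d → w ≡ pre ++ 1 ∷ suc (suc d) ∷ []
∈-Al⁻ n {w} w∈
  with w∈A , t ← ∈-filter⁻ (λ w → T? (penultIs1 w)) {xs = A n} w∈
  with pre , d , refl ← penultIs1⁻ w (Equivalence.to T-≡ t)
  with p , av ← ∈-A⁻ n w∈A
  with s≤s (s≤s {n = d′} _) ← ≤∧≢⇒< (proj₁ (∈⇒inRange p (∈-++⁺ʳ pre (there (here refl)))))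
                                     (unique-last-two pre (unique p))
  = (p , av) , pre , d′ , refl

∈-Al⁺ : ∀ n pre d → IsA n (pre ++ 1 ∷ d ∷ []) → pre ++ 1 ∷ d ∷ [] ∈ Al n
∈-Al⁺ n pre d a =
  ∈-filter⁺ (λ w → T? (penultIs1 w)) (∈-A⁺ n a) (Equivalence.from T-≡ (penultIs1-∷ʳ pre 1 d))

extend-isA⁻ : ∀ {n c} pre → IsA (suc n) (pre ++ [ c ]) →
  IsA n (map (punchOut c) pre) × pre ++ [ c ] ≡ extend c (map (punchOut c) pre)
extend-isA⁻ {c = c} pre (p , av) with p′ , w≡ ← extend-isPerm⁻ pre p =
  (p′ , avoids-extend⁻ c (map (punchOut c) pre) (subst Avoids w≡ av)) , w≡

extend1-isA : ∀ m {u} → u ∈ Al m → IsA (suc m) (extend 1 u)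
extend1-isA m u∈ with (p , av) , pre , d , refl ← ∈-Al⁻ m u∈ =
  extend-isPerm p (s≤s z≤n , s≤s z≤n) , trans (occ-extend isBad 1 (isBad-punchIn 1) pre 1 (2 + d)) (cong (_+ 0) av)

extend1-∈-Ar : ∀ m {u} → u ∈ Al m → extend 1 u ∈ Ar (suc m)
extend1-∈-Ar m {u} u∈ = ∈-Ar⁺ (suc m) (map (punchIn 1) u) (extend1-isA m u∈)

occ312-extend1 : ∀ m {u} → u ∈ Al m → occ is312 (extend 1 u) ≡ occ is312 u
occ312-extend1 m u∈ with _ , pre , d , refl ← ∈-Al⁻ m u∈ =
  trans (occ-extend is312 1 (is312-punchIn 1) pre 1 (2 + d)) (+-identityʳ _)

-- The last window of extend 1 (q ++ x ∷ 1 ∷ []) is the 321 (x + 1, 2, 1).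
¬avoids-extend1-∷ʳ-1 : ∀ {m} pre → 2 ≤ m → IsPerm m (pre ++ [ 1 ]) → ¬ Avoids (extend 1 (pre ++ [ 1 ]))
¬avoids-extend1-∷ʳ-1 pre 2≤m p av with reverseView pre
... | [] = case inRange⇒∈ p (s≤s z≤n , 2≤m) of λ { (here ()) ; (there ()) }
... | q ∶ _ ∶ʳ x
  with p′ ← subst (IsPerm _) (++-assoc q [ x ] [ 1 ]) p
  with s≤s (s≤s {n = x′} _) ← ≤∧≢⇒< (proj₁ (∈⇒inRange p′ (∈-++⁺ʳ q (here refl))))
                                    (unique-last-two q (unique p′) ∘ sym)
  with () ← m+n≡0⇒n≡0 (occ isBad (q ++ 2 + x′ ∷ 1 ∷ []))
              (trans (sym (occ-extend isBad 1 (isBad-punchIn 1) q (2 + x′) 1))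
                     (subst (Avoids ∘ extend 1) (++-assoc q [ x ] [ 1 ]) av))

Ar⇒extend1 : ∀ {m w} → 2 ≤ m → w ∈ Ar (suc m) → ∃ λ u → u ∈ Al m × w ≡ extend 1 u
Ar⇒extend1 {m} 2≤m w∈
  with a , pre , refl ← ∈-Ar⁻ (suc m) w∈
  with (pv , v-av) , w≡ ← extend-isA⁻ pre a
  with minimum-in-last-two (map (punchOut 1) pre) (unique pv) v-av (proj₁ ∘ ∈⇒inRange pv)
         (inRange⇒∈ pv (≤-refl , ≤-trans (s≤s z≤n) 2≤m))
... | inj₁ (pre′ , v≡) = ⊥-elim (¬avoids-extend1-∷ʳ-1 pre′ 2≤m (subst (IsPerm m) v≡ pv)
                                   (subst (Avoids ∘ extend 1) v≡ (subst Avoids w≡ (proj₂ a))))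
... | inj₂ (pre′ , z , v≡) =
  _ , ∈-Al⁺ m pre′ z (subst (IsA m) v≡ (pv , v-av)) , trans w≡ (cong (extend 1) v≡)

extend1-Al-shape : ∀ pre d →
  extend 1 (pre ++ 1 ∷ suc (suc d) ∷ []) ≡ (map (punchIn 1) pre ++ [ 2 ]) ++ 3 + d ∷ 1 ∷ []
extend1-Al-shape pre d = begin
  map (punchIn 1) (pre ++ 1 ∷ 2 + d ∷ []) ++ [ 1 ]    ≡⟨ cong (_++ [ 1 ]) (map-++ (punchIn 1) pre _) ⟩
  (map (punchIn 1) pre ++ 2 ∷ 3 + d ∷ []) ++ [ 1 ]    ≡⟨ ++-assoc (map (punchIn 1) pre) _ [ 1 ] ⟩
  map (punchIn 1) pre ++ 2 ∷ 3 + d ∷ 1 ∷ []            ≡⟨ ++-assoc (map (punchIn 1) pre) [ 2 ] _ ⟨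
  (map (punchIn 1) pre ++ [ 2 ]) ++ 3 + d ∷ 1 ∷ []    ∎

occ-extend2 : ∀ p i → Invariant p (punchIn (2 + i)) → ∀ pre d →
  occ p (extend (2 + i) (extend 1 (pre ++ 1 ∷ 2 + d ∷ []))) ≡
  occ p (extend 1 (pre ++ 1 ∷ 2 + d ∷ [])) + occ p (2 + punchIn i (suc d) ∷ 1 ∷ 2 + i ∷ [])
occ-extend2 p i inv pre d =
  trans (cong (occ p ∘ extend (2 + i)) (extend1-Al-shape pre d))
    (trans (occ-extend p (2 + i) inv (map (punchIn 1) pre ++ [ 2 ]) (3 + d) 1)
      (cong (λ w → occ p w + _) (sym (extend1-Al-shape pre d))))

extend-∷ʳ-1 : ∀ i v → extend (2 + i) (v ++ [ 1 ]) ≡ map (punchIn (2 + i)) v ++ 1 ∷ 2 + i ∷ []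
extend-∷ʳ-1 i v =
  trans (cong (_++ [ 2 + i ]) (map-++ (punchIn (2 + i)) v [ 1 ])) (++-assoc (map (punchIn (2 + i)) v) [ 1 ] _)

extend2-∈-Al : ∀ k {u i} → u ∈ Al k → i ≤ k → extend (2 + i) (extend 1 u) ∈ Al (2 + k)
extend2-∈-Al k {u} {i} u∈ i≤k with (p , av) , pre , d , refl ← ∈-Al⁻ k u∈ =
  subst (_∈ Al (2 + k)) (sym (extend-∷ʳ-1 i (map (punchIn 1) u)))
    (∈-Al⁺ (2 + k) _ (2 + i) (subst (IsA (2 + k)) (extend-∷ʳ-1 i (map (punchIn 1) u))
      (extend-isPerm (proj₁ (extend1-isA k u∈)) (s≤s z≤n , s≤s (s≤s i≤k)) , avoids)))
  where
    avoids : Avoids (extend (2 + i) (extend 1 u))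
    avoids rewrite occ-extend2 isBad i (isBad-punchIn (2 + i)) pre d
                 | isBad-valley (suc (punchIn i (suc d))) (suc i) = trans (+-identityʳ _) (proj₂ (extend1-isA k u∈))

lastEntry : List ℕ → ℕ
lastEntry []           = 0
lastEntry (x ∷ [])     = x
lastEntry (_ ∷ y ∷ ys) = lastEntry (y ∷ ys)

lastEntry-++ : ∀ xs y ys → lastEntry (xs ++ y ∷ ys) ≡ lastEntry (y ∷ ys)
lastEntry-++ []           y ys = refl
lastEntry-++ (_ ∷ [])     y ys = refl
lastEntry-++ (_ ∷ x ∷ xs) y ys = lastEntry-++ (x ∷ xs) y ys

lastEntry-extend : ∀ c v → lastEntry (extend c v) ≡ c
lastEntry-extend c v = lastEntry-++ (map (punchIn c) v) c []

occ312-extend2 : ∀ k {u} i → u ∈ Al k →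
  occ is312 (extend (2 + i) (extend 1 u)) ≡ occ is312 u + (if i <ᵇ lastEntry u then 1 else 0)
occ312-extend2 k i u∈ with _ , pre , d , refl ← ∈-Al⁻ k u∈ = begin
  occ is312 (extend (2 + i) (extend 1 u))
    ≡⟨ occ-extend2 is312 i (is312-punchIn (2 + i)) pre d ⟩
  occ is312 (extend 1 u) + ((if i <ᵇ punchIn i (suc d) then 1 else 0) + 0)
    ≡⟨ cong₂ _+_ (occ312-extend1 k u∈) (+-identityʳ _) ⟩
  occ is312 u + (if i <ᵇ punchIn i (suc d) then 1 else 0)
    ≡⟨ cong (λ b → occ is312 u + (if b then 1 else 0))
         (trans (punchIn-<ᵇ-self i (suc d)) (cong (i <ᵇ_) (sym (lastEntry-++ pre 1 (2 + d ∷ []))))) ⟩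
  occ is312 u + (if i <ᵇ lastEntry u then 1 else 0) ∎
  where u = pre ++ 1 ∷ 2 + d ∷ []

Al⇒extend2 : ∀ {k w} → 2 ≤ k → w ∈ Al (2 + k) →
  ∃₂ λ u i → u ∈ Al k × i ≤ k × w ≡ extend (2 + i) (extend 1 u)
Al⇒extend2 {k} 2≤k w∈
  with a , pre , i , refl ← ∈-Al⁻ (2 + k) w∈
  with a′ , w≡ ← extend-isA⁻ (pre ++ [ 1 ]) (subst (IsA (2 + k)) (sym (++-assoc pre [ 1 ] [ 2 + i ])) a)
  with u , u∈ , v≡ ← Ar⇒extend1 2≤k
         (∈-Ar⁺ (suc k) (map (punchOut (2 + i)) pre) (subst (IsA (suc k)) (map-++ (punchOut (2 + i)) pre [ 1 ]) a′))
  = u , i , u∈ , s≤s⁻¹ (s≤s⁻¹ (proj₂ (∈⇒inRange (proj₁ a) (∈-++⁺ʳ pre (there (here refl)))))) , (begin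
      pre ++ 1 ∷ 2 + i ∷ []                                   ≡⟨ ++-assoc pre [ 1 ] [ 2 + i ] ⟨
      (pre ++ [ 1 ]) ++ [ 2 + i ]                              ≡⟨ w≡ ⟩
      extend (2 + i) (map (punchOut (2 + i)) (pre ++ [ 1 ]))   ≡⟨ cong (extend (2 + i)) (map-++ (punchOut (2 + i)) pre [ 1 ]) ⟩
      extend (2 + i) (map (punchOut (2 + i)) pre ++ [ 1 ])     ≡⟨ cong (extend (2 + i)) v≡ ⟩
      extend (2 + i) (extend 1 u)                              ∎)

module _ {A : Set} (f : A → ℕ) where

  sum-map-unique-cong : ∀ {xs ys} → Unique xs → Unique ys →
    (∀ {z} → z ∈ xs → z ∈ ys) → (∀ {z} → z ∈ ys → z ∈ xs) → sum (map f xs) ≡ sum (map f ys)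
  sum-map-unique-cong ux uy xs⊆ys ys⊆xs =
    sum-↭ (↭.map⁺ f (∼bag⇒↭ (unique∧set⇒bag ux uy (mk⇔ xs⊆ys ys⊆xs))))

  sum-map-concatMap : ∀ {B : Set} (g : B → List A) xs →
    sum (map f (concatMap g xs)) ≡ sum (map (λ b → sum (map f (g b))) xs)
  sum-map-concatMap g []       = refl
  sum-map-concatMap g (b ∷ xs) = begin
    sum (map f (g b ++ concatMap g xs))               ≡⟨ cong sum (map-++ f (g b) _) ⟩
    sum (map f (g b) ++ map f (concatMap g xs))       ≡⟨ sum-++ (map f (g b)) _ ⟩
    sum (map f (g b)) + sum (map f (concatMap g xs))  ≡⟨ cong (sum (map f (g b)) +_) (sum-map-concatMap g xs) ⟩
    sum (map f (g b)) + sum (map (λ b → sum (map f (g b))) xs) ∎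

sum-map-const : ∀ {A : Set} (xs : List A) a → sum (map (λ _ → a) xs) ≡ length xs * a
sum-map-const []       a = refl
sum-map-const (x ∷ xs) a = cong (a +_) (sum-map-const xs a)

sum-map-+ : ∀ {A : Set} (f g : A → ℕ) xs → sum (map (λ x → f x + g x) xs) ≡ sum (map f xs) + sum (map g xs)
sum-map-+ f g []       = refl
sum-map-+ f g (x ∷ xs) = begin
  (f x + g x) + sum (map (λ x → f x + g x) xs)     ≡⟨ cong (f x + g x +_) (sum-map-+ f g xs) ⟩
  (f x + g x) + (sum (map f xs) + sum (map g xs))   ≡⟨ interchange (f x) (g x) _ _ ⟩
  (f x + sum (map f xs)) + (g x + sum (map g xs))   ∎

sum-map-*ˡ : ∀ {A : Set} a (f : A → ℕ) xs → sum (map (λ x → a * f x) xs) ≡ a * sum (map f xs)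
sum-map-*ˡ a f []       = sym (*-zeroʳ a)
sum-map-*ˡ a f (x ∷ xs) = trans (cong (a * f x +_) (sum-map-*ˡ a f xs)) (sym (*-distribˡ-+ a (f x) _))

sum-map-cong-∈ : ∀ {A : Set} {f g : A → ℕ} xs → (∀ {x} → x ∈ xs → f x ≡ g x) →
  sum (map f xs) ≡ sum (map g xs)
sum-map-cong-∈ xs f≡g = cong sum (map-cong-local (All.tabulate f≡g))

count-below : ∀ n e → sum (map (λ i → if i <ᵇ e then 1 else 0) (downFrom n)) ≡ n ⊓ e
count-below zero    e = refl
count-below (suc n) e with n <ᵇ e in n<ᵇe
... | true  = trans (cong suc (trans (count-below n e) (m≤n⇒m⊓n≡m (<⇒≤ n<e)))) (sym (m≤n⇒m⊓n≡m n<e))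
  where n<e = <ᵇ⇒< n e (subst T (sym n<ᵇe) _)
... | false = trans (count-below n e) (trans (m≥n⇒m⊓n≡n e≤n) (sym (m≥n⇒m⊓n≡n (m≤n⇒m≤1+n e≤n))))
  where e≤n = ≮⇒≥ (λ n<e → subst T n<ᵇe (<⇒<ᵇ n<e))

A-unique : ∀ n → Unique (A n)
A-unique n = Unique.filter⁺ _ (perms-unique n)

Ar-unique : ∀ n → Unique (Ar n)
Ar-unique n = Unique.filter⁺ _ (A-unique n)

Al-unique : ∀ n → Unique (Al n)
Al-unique n = Unique.filter⁺ _ (A-unique n)

sum-Ar : ∀ {m} → 2 ≤ m → (f : List ℕ → ℕ) → sum (map f (Ar (suc m))) ≡ sum (map (f ∘ extend 1) (Al m))
sum-Ar {m} 2≤m f = begin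
  sum (map f (Ar (suc m)))
    ≡⟨ sum-map-unique-cong f (Ar-unique (suc m)) (Unique.map⁺ (proj₂ ∘ extend-injective) (Al-unique m))
         Ar⊆ ⊆Ar ⟩
  sum (map f (map (extend 1) (Al m)))
    ≡⟨ cong sum (map-∘ (Al m)) ⟨
  sum (map (f ∘ extend 1) (Al m)) ∎
  where
    Ar⊆ : ∀ {w} → w ∈ Ar (suc m) → w ∈ map (extend 1) (Al m)
    Ar⊆ w∈ with u , u∈ , refl ← Ar⇒extend1 2≤m w∈ = ∈-map⁺ (extend 1) u∈
    ⊆Ar : ∀ {w} → w ∈ map (extend 1) (Al m) → w ∈ Ar (suc m)
    ⊆Ar w∈ with u , u∈ , refl ← ∈-map⁻ (extend 1) w∈ = extend1-∈-Ar m u∈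

-- The elements of A^l_{k+2} obtained from u ∈ A^l_k; their last entries c = 2 + i run over
-- 2, …, k + 2.
extensions : ℕ → List ℕ → List (List ℕ)
extensions k u = map (λ i → extend (2 + i) (extend 1 u)) (downFrom (suc k))

sum-Al : ∀ {k} → 2 ≤ k → (f : List ℕ → ℕ) →
  sum (map f (Al (2 + k))) ≡
  sum (map (λ u → sum (map (λ i → f (extend (2 + i) (extend 1 u))) (downFrom (suc k)))) (Al k))
sum-Al {k} 2≤k f = begin
  sum (map f (Al (2 + k)))
    ≡⟨ sum-map-unique-cong f (Al-unique (2 + k)) extensions-unique Al⊆ ⊆Al ⟩
  sum (map f (concatMap (extensions k) (Al k)))
    ≡⟨ sum-map-concatMap f (extensions k) (Al k) ⟩
  sum (map (λ u → sum (map f (extensions k u))) (Al k))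
    ≡⟨ cong sum (map-cong (λ u → cong sum (map-∘ (downFrom (suc k)))) (Al k)) ⟨
  sum (map (λ u → sum (map (λ i → f (extend (2 + i) (extend 1 u))) (downFrom (suc k)))) (Al k)) ∎
  where
    extend2-injective : ∀ {u v i j} → extend (2 + i) (extend 1 u) ≡ extend (2 + j) (extend 1 v) → i ≡ j × u ≡ v
    extend2-injective eq with 2+i≡2+j , eq′ ← extend-injective eq =
      suc-injective (suc-injective 2+i≡2+j) , proj₂ (extend-injective eq′)
    extensions-unique : Unique (concatMap (extensions k) (Al k))
    extensions-unique = concatMap-unique (extensions k) (Al-unique k)
      (λ _ → Unique.map⁺ (proj₁ ∘ extend2-injective) (Unique.downFrom⁺ (suc k)))
      λ _ _ w∈u w∈v →
        let _ , _ , w≡u = ∈-map⁻ _ w∈u ; _ , _ , w≡v = ∈-map⁻ _ w∈v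
        in proj₂ (extend2-injective (trans (sym w≡u) w≡v))
    Al⊆ : ∀ {w} → w ∈ Al (2 + k) → w ∈ concatMap (extensions k) (Al k)
    Al⊆ w∈ with u , i , u∈ , i≤k , refl ← Al⇒extend2 2≤k w∈ =
      ∈-concatMap⁺ (extensions k) (lose u∈ (∈-map⁺ _ (∈-downFrom⁺ (s≤s i≤k))))
    ⊆Al : ∀ {w} → w ∈ concatMap (extensions k) (Al k) → w ∈ Al (2 + k)
    ⊆Al w∈ with u , u∈ , w∈u ← find (∈-concatMap⁻ (extensions k) {xs = Al k} w∈)
           with i , i∈ , refl ← ∈-map⁻ _ w∈u =
      extend2-∈-Al k u∈ (s≤s⁻¹ (∈-downFrom⁻ i∈))

occ312r≡occ312l : ∀ m → 2 ≤ m → occ312r (suc m) ≡ occ312l m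
occ312r≡occ312l m 2≤m =
  trans (sum-Ar 2≤m (occ is312)) (sum-map-cong-∈ (Al m) (occ312-extend1 m))

lastSum : ℕ → ℕ
lastSum k = sum (map lastEntry (Al k))

lastEntry-≤ : ∀ {k u} → u ∈ Al k → lastEntry u ≤ k
lastEntry-≤ {k} u∈ with (p , _) , pre , d , refl ← ∈-Al⁻ k u∈ =
  subst (_≤ k) (sym (lastEntry-++ pre 1 _)) (proj₂ (∈⇒inRange p (∈-++⁺ʳ pre (there (here refl)))))

length-as-sum : ∀ {A : Set} (xs : List A) → length xs ≡ sum (map (λ _ → 1) xs)
length-as-sum xs = sym (trans (sum-map-const xs 1) (*-identityʳ (length xs)))

length-Al-rec : ∀ k → 2 ≤ k → length (Al (2 + k)) ≡ suc k * length (Al k)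
length-Al-rec k 2≤k = begin
  length (Al (2 + k))
    ≡⟨ length-as-sum (Al (2 + k)) ⟩
  sum (map (λ _ → 1) (Al (2 + k)))
    ≡⟨ sum-Al 2≤k (λ _ → 1) ⟩
  sum (map (λ _ → sum (map (λ _ → 1) (downFrom (suc k)))) (Al k))
    ≡⟨ sum-map-const (Al k) _ ⟩
  length (Al k) * sum (map (λ _ → 1) (downFrom (suc k)))
    ≡⟨ cong (length (Al k) *_) (trans (sym (length-as-sum (downFrom (suc k)))) (length-downFrom (suc k))) ⟩
  length (Al k) * suc k
    ≡⟨ *-comm (length (Al k)) (suc k) ⟩
  suc k * length (Al k) ∎

lastSum-rec : ∀ k → 2 ≤ k → lastSum (2 + k) ≡ length (Al k) * sum (map (2 +_) (downFrom (suc k)))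
lastSum-rec k 2≤k = begin
  lastSum (2 + k)
    ≡⟨ sum-Al 2≤k lastEntry ⟩
  sum (map (λ u → sum (map (λ i → lastEntry (extend (2 + i) (extend 1 u))) (downFrom (suc k)))) (Al k))
    ≡⟨ cong sum (map-cong (λ u → cong sum (map-cong (λ i → lastEntry-extend (2 + i) (extend 1 u)) (downFrom (suc k))))
                          (Al k)) ⟩
  sum (map (λ _ → sum (map (2 +_) (downFrom (suc k)))) (Al k))
    ≡⟨ sum-map-const (Al k) _ ⟩
  length (Al k) * sum (map (2 +_) (downFrom (suc k))) ∎

occ312l-rec : ∀ k → 2 ≤ k → occ312l (2 + k) ≡ suc k * occ312l k + lastSum k
occ312l-rec k 2≤k = begin
  occ312l (2 + k)
    ≡⟨ sum-Al 2≤k (occ is312) ⟩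
  sum (map (λ u → sum (map (λ i → occ is312 (extend (2 + i) (extend 1 u))) (downFrom (suc k)))) (Al k))
    ≡⟨ sum-map-cong-∈ (Al k) extensions-occ ⟩
  sum (map (λ u → suc k * occ is312 u + lastEntry u) (Al k))
    ≡⟨ sum-map-+ (λ u → suc k * occ is312 u) lastEntry (Al k) ⟩
  sum (map (λ u → suc k * occ is312 u) (Al k)) + lastSum k
    ≡⟨ cong (_+ lastSum k) (sum-map-*ˡ (suc k) (occ is312) (Al k)) ⟩
  suc k * occ312l k + lastSum k ∎
  where
    extensions-occ : ∀ {u} → u ∈ Al k →
      sum (map (λ i → occ is312 (extend (2 + i) (extend 1 u))) (downFrom (suc k))) ≡ suc k * occ is312 u + lastEntry u
    extensions-occ {u} u∈ = begin
      sum (map (λ i → occ is312 (extend (2 + i) (extend 1 u))) (downFrom (suc k)))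
        ≡⟨ cong sum (map-cong (λ i → occ312-extend2 k i u∈) (downFrom (suc k))) ⟩
      sum (map (λ i → occ is312 u + (if i <ᵇ lastEntry u then 1 else 0)) (downFrom (suc k)))
        ≡⟨ sum-map-+ (λ _ → occ is312 u) _ (downFrom (suc k)) ⟩
      sum (map (λ _ → occ is312 u) (downFrom (suc k)))
        + sum (map (λ i → if i <ᵇ lastEntry u then 1 else 0) (downFrom (suc k)))
        ≡⟨ cong₂ _+_ (trans (sum-map-const (downFrom (suc k)) _) (cong (_* occ is312 u) (length-downFrom (suc k))))
                     (trans (count-below (suc k) (lastEntry u)) (m≥n⇒m⊓n≡n (m≤n⇒m≤1+n (lastEntry-≤ u∈)))) ⟩
      suc k * occ is312 u + lastEntry u ∎

length-Al : ∀ j → length (Al (2 + j)) ≡ suc j !!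
length-Al zero          = refl
length-Al (suc zero)    = refl
length-Al (suc (suc j)) = trans (length-Al-rec (2 + j) (s≤s (s≤s z≤n))) (cong ((3 + j) *_) (length-Al j))

gauss : ∀ m → 2 * sum (map suc (downFrom m)) ≡ m * suc m
gauss zero    = refl
gauss (suc m) = begin
  2 * (suc m + sum (map suc (downFrom m)))      ≡⟨ *-distribˡ-+ 2 (suc m) _ ⟩
  2 * suc m + 2 * sum (map suc (downFrom m))    ≡⟨ cong (2 * suc m +_) (gauss m) ⟩
  2 * suc m + m * suc m                         ≡⟨ collect m ⟩
  suc m * suc (suc m)                           ∎
  where
    collect : ∀ m → 2 * suc m + m * suc m ≡ suc m * suc (suc m)
    collect = solve-∀

half-gauss : ∀ m → m * suc m / 2 ≡ sum (map suc (downFrom m))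
half-gauss m = begin
  m * suc m / 2                                  ≡⟨ cong (_/ 2) (gauss m) ⟨
  2 * sum (map suc (downFrom m)) / 2             ≡⟨ cong (_/ 2) (*-comm 2 (sum (map suc (downFrom m)))) ⟩
  sum (map suc (downFrom m)) * 2 / 2             ≡⟨ m*n/n≡m _ 2 ⟩
  sum (map suc (downFrom m))                     ∎

sum-2+-plus-sum-suc : ∀ m → sum (map (2 +_) (downFrom m)) + sum (map suc (downFrom m)) ≡ m * (2 + m)
sum-2+-plus-sum-suc zero    = refl
sum-2+-plus-sum-suc (suc m) = begin
  (2 + m + sum (map (2 +_) (downFrom m))) + (suc m + sum (map suc (downFrom m)))
    ≡⟨ interchange (2 + m) _ (suc m) _ ⟩
  (2 + m + suc m) + (sum (map (2 +_) (downFrom m)) + sum (map suc (downFrom m)))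
    ≡⟨ cong (2 + m + suc m +_) (sum-2+-plus-sum-suc m) ⟩
  (2 + m + suc m) + m * (2 + m)
    ≡⟨ collect m ⟩
  suc m * (3 + m) ∎
  where
    collect : ∀ m → (2 + m + suc m) + m * (2 + m) ≡ suc m * (3 + m)
    collect = solve-∀

factor-2+a : ∀ a L X → (2 + a) * L + X * (a * (2 + a)) ≡ (2 + a) * (L + a * X)
factor-2+a = solve-∀

occ312l-identity : ∀ j →
  occ312l (6 + j) + (1 + j) !! * ((3 + j) * (4 + j) / 2) ≡ (5 + j) * (occ312l (4 + j) + (3 + j) !!)
occ312l-identity j = begin
  occ312l (6 + j) + X * (m * suc m / 2)
    ≡⟨ cong₂ _+_ (occ312l-rec (4 + j) (s≤s (s≤s z≤n))) (cong (X *_) (half-gauss m)) ⟩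
  ((5 + j) * L + lastSum (4 + j)) + X * S₁
    ≡⟨ cong (λ s → ((5 + j) * L + s) + X * S₁)
         (trans (lastSum-rec (2 + j) (s≤s (s≤s z≤n))) (cong (_* S₂) (length-Al j))) ⟩
  ((5 + j) * L + X * S₂) + X * S₁
    ≡⟨ +-assoc ((5 + j) * L) _ _ ⟩
  (5 + j) * L + (X * S₂ + X * S₁)
    ≡⟨ cong ((5 + j) * L +_) (trans (sym (*-distribˡ-+ X S₂ S₁)) (cong (X *_) (sum-2+-plus-sum-suc m))) ⟩
  (5 + j) * L + X * (m * (2 + m))
    ≡⟨ factor-2+a m L X ⟩
  (5 + j) * (L + (3 + j) * X) ∎
  where
    m = 3 + j
    L = occ312l (4 + j)
    X = (1 + j) !!
    S₁ = sum (map suc (downFrom m))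
    S₂ = sum (map (2 +_) (downFrom m))

mainTheorem2 : (n : ℕ) → 5 ≤ n →
    (occ312r n ≡ occ312l (n ∸ 1)) ×
    (occ312l n + ((n ∸ 5) !!) * (((n ∸ 3) * (n ∸ 2)) / 2)
      ≡ (n ∸ 1) * (occ312l (n ∸ 2) + ((n ∸ 3) !!)))
mainTheorem2 _ (s≤s (s≤s (s≤s (s≤s (s≤s {n = k} _))))) =
  occ312r≡occ312l (4 + k) (s≤s (s≤s z≤n)) , identity k
  where
    identity : ∀ k → occ312l (5 + k) + k !! * ((2 + k) * (3 + k) / 2) ≡ (4 + k) * (occ312l (3 + k) + (2 + k) !!)
    identity zero    = refl
    identity (suc j) = occ312l-identity j
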